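{- Let $\mathfrak M=\mathfrak M_1 c\,\mathfrak M_2\, d\,\mathfrak M_3$ be a word or $\omega$-word (concatenation, where $c,d$ are single elements and $\mathfrak M_1,\mathfrak M_2,\mathfrak M_3$ are possibly empty segments), and let $k>0$ be a natural number. Assume that the $k$-profiles of $c$ and $d$ in $\mathfrak M$ are equal, and let $\mathfrak M'=\mathfrak M_1 c\,\mathfrak M_3$. Then for every $b\in M'$, the $k$-profile of $b$ in $\mathfrak M'$ equals the $k$-profile of $b$ in $\mathfrak M$.
   Context: A word is a finite structure over $\sigma_0\cup\{\mathrm{succ},<\}$, $\sigma_0$ a finite set of unary relation symbols, $<$ a strict linear order and $\mathrm{succ}$ its induced successor; an $\omega$-word is an infinite such structure whose $\{\mathrm{succ},<\}$-reduct is isomorphic to $(\mathbb N,+1,<)$. Concatenation of words is the obvious operation placing one word after the other. For a tuple $a_1,\dots,a_s$ of elements, its type is the set of atomic and negated atomic formulas (over $\sigma_0$, $\mathrm{succ}$, $<$, $=$) in variables $x_1,\dots,x_s$ true under $x_i\mapsto a_i$. The $k$-profile of $a$ in a word is the triple $(\mathcal F,\mathcal L,\mathcal R)$: $\mathcal F$ is the set of types of all tuples $a_1,\dots,a_s$ with $1\le s\le k$ and $a_1=a$; $\mathcal L$ the subset of types of such tuples with $a_i<a$ for all $2\le i\le s$; $\mathcal R$ the subset with $a<a_i$ for all $2\le i\le s$. -}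

module Defs where

open import Data.Nat using (ℕ; zero; suc; _+_; _≤_; _<_; _≤ᵇ_; _≟_; _<?_)
open import Data.Fin using (Fin) renaming (zero to fzero; suc to fsuc)
open import Data.Bool using (Bool; false; if_then_else_)
open import Data.List using (List; []; _∷_; _++_; length)
open import Data.Unit using (⊤)
open import Data.Product using (Σ; _×_)
open import Relation.Nullary.Decidable using (⌊_⌋)
open import Relation.Binary.PropositionalEquality using (_≡_)
open import Function.Bundles using (_⇔_)

-- σ₀ = Fin m (m unary relation symbols).  A label says which unary
-- relations hold at a position.
Label : ℕ → Set
Label m = Fin m → Bool

-- A word (finite) or an ω-word.  Elements are the positions 0,1,2,…
-- with < and succ the usual ones on ℕ.
data Word (m : ℕ) : Set where
  fin   : List (Label m) → Word m
  omega : (ℕ → Label m) → Word m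

prepend : {A : Set} → List A → (ℕ → A) → ℕ → A
prepend []      f i       = f i
prepend (x ∷ l) f zero    = x
prepend (x ∷ l) f (suc i) = prepend l f i

_⊙_ : {m : ℕ} → List (Label m) → Word m → Word m
l ⊙ fin l'  = fin (l ++ l')
l ⊙ omega f = omega (prepend l f)

Dom : {m : ℕ} → Word m → ℕ → Set
Dom (fin l)   p = p < length l
Dom (omega f) p = ⊤

at : {m : ℕ} → List (Label m) → ℕ → Label m
at []      i       = λ _ → false
at (x ∷ l) zero    = x
at (x ∷ l) (suc i) = at l i

-- unary relations at a position (irrelevant outside the domain)
lab : {m : ℕ} → Word m → ℕ → Label m
lab (fin l)   p = at l p
lab (omega f) p = f p

data Atom (m n : ℕ) : Set where
  rel  : Fin m → Fin n → Atom m n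
  eq   : Fin n → Fin n → Atom m n
  lt   : Fin n → Fin n → Atom m n
  succ : Fin n → Fin n → Atom m n

holds : {m n : ℕ} → Word m → (Fin n → ℕ) → Atom m n → Bool
holds w t (rel r i)  = lab w (t i) r
holds w t (eq i j)   = ⌊ t i ≟ t j ⌋
holds w t (lt i j)   = ⌊ t i <? t j ⌋
holds w t (succ i j) = ⌊ suc (t i) ≟ t j ⌋

-- A type in n variables: the set of atomic and negated atomic formulas,
-- encoded by the truth value of each atomic formula (φ ∈ type iff true,
-- ¬φ ∈ type iff false).
Type : ℕ → ℕ → Set
Type m n = Atom m n → Bool

data Side : Set where
  F L R : Side

Cond : Side → ℕ → ℕ → Set
Cond F a x = ⊤
Cond L a x = x < a
Cond R a x = a < x

-- τ (a type in s = suc n variables) belongs to the component σ of the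
-- k-profile of a in w: it is the type of some tuple a₁…a_s of elements
-- of w with 1 ≤ s ≤ k, a₁ = a, and (for L / R) a_i < a / a < a_i, i ≥ 2.
InProfile : {m : ℕ} → Side → ℕ → Word m → ℕ → (n : ℕ) → Type m (suc n) → Set
InProfile σ k w a n τ =
  suc n ≤ k ×
  Σ (Fin (suc n) → ℕ) λ t →
    (∀ i → Dom w (t i)) ×
    t fzero ≡ a ×
    (∀ i → Cond σ a (t (fsuc i))) ×
    (∀ φ → holds w t φ ≡ τ φ)

SameProfile : {m : ℕ} → ℕ → Word m → ℕ → Word m → ℕ → Set
SameProfile k w a w' b =
  ∀ σ n (τ : Type _ (suc n)) → InProfile σ k w a n τ ⇔ InProfile σ k w' b n τ

-- the canonical embedding of M' = M₁ c M₃ into M = M₁ c M₂ d M₃: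
-- positions ≤ i (= position of c) are fixed, later ones shift by g = |M₂ d|.
skip : ℕ → ℕ → ℕ → ℕ
skip i g b = if b ≤ᵇ i then b else b + g

{-# OPTIONS --safe #-}
-- M′ sits inside M by fixing the positions up to c and moving the later ones past d.
-- A tuple starting at b is cut at c, or at d when it lies in M and starts beyond d.
-- The half containing b is carried over by this embedding (or its inverse); the other
-- half is not, because the embedding breaks succ between c and its successor. Instead,
-- collapse the half containing b onto c or d, realise the collapsed tuple at the other
-- one using their equal profiles, and take the other half from the realising tuple.
-- Both halves then relate to the cut exactly as in the original tuple, which is enough
-- for the glued tuple to have the original atomic type.
module Submission where

open import Defs
open import Data.Nat using (ℕ; zero; suc; _+_; _∸_; _≤_; _<_; _≤ᵇ_; z≤n; s≤s)
open import Data.Nat.Properties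
open import Algebra.Properties.CommutativeSemigroup +-commutativeSemigroup using (x∙yz≈xz∙y)
open import Data.Fin using (Fin) renaming (zero to fzero; suc to fsuc)
open import Data.Bool using (true; false; if_then_else_)
open import Data.List using (List; []; _∷_; _++_; length)
open import Data.List.Properties using (length-++; ++-assoc)
open import Data.Product using (_,_)
open import Data.Sum using (inj₁; inj₂)
open import Data.Unit using (tt)
open import Data.Empty using (⊥-elim)
open import Function using (_∘_; const)
open import Function.Bundles using (_⇔_; mk⇔; Equivalence)
import Function.Properties.Equivalence as ⇔
open import Relation.Nullary using (Dec; yes; no; ¬_)
open import Relation.Nullary.Decidable using (⌊_⌋; does-⇔; isYes≗does)
open import Relation.Binary.PropositionalEquality

open Equivalence using (to; from)

⇔-true : {P Q : Set} → P → Q → P ⇔ Q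
⇔-true p q = mk⇔ (const q) (const p)

⇔-false : {P Q : Set} → ¬ P → ¬ Q → P ⇔ Q
⇔-false ¬p ¬q = mk⇔ (⊥-elim ∘ ¬p) (⊥-elim ∘ ¬q)

⌊⌋-⇔ : {P Q : Set} → P ⇔ Q → (p? : Dec P) (q? : Dec Q) → ⌊ p? ⌋ ≡ ⌊ q? ⌋
⌊⌋-⇔ P⇔Q p? q? = trans (isYes≗does p?) (trans (does-⇔ P⇔Q p? q?) (sym (isYes≗does q?)))

⌊⌋-≡⇒⇔ : {P Q : Set} (p? : Dec P) (q? : Dec Q) → ⌊ p? ⌋ ≡ ⌊ q? ⌋ → P ⇔ Q
⌊⌋-≡⇒⇔ (yes p) (yes q) _ = ⇔-true p q
⌊⌋-≡⇒⇔ (no ¬p) (no ¬q) _ = ⇔-false ¬p ¬q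
⌊⌋-≡⇒⇔ (yes _) (no _) ()
⌊⌋-≡⇒⇔ (no _) (yes _) ()

if-≤ᵇ-≤ : {A : Set} {a α : ℕ} {x y : A} → a ≤ α → (if a ≤ᵇ α then x else y) ≡ x
if-≤ᵇ-≤ {a = a} {α} a≤α with a ≤ᵇ α | ≤⇒≤ᵇ a≤α
... | true | _ = refl

if-≤ᵇ-> : {A : Set} {a α : ℕ} {x y : A} → α < a → (if a ≤ᵇ α then x else y) ≡ y
if-≤ᵇ-> {a = a} {α} α<a with a ≤ᵇ α | ≤ᵇ⇒≤ a α
... | true  | a≤α = ⊥-elim (<⇒≱ α<a (a≤α tt))
... | false | _   = refl

record SameOrder (a b a′ b′ : ℕ) : Set where
  field
    ≡-⇔    : a ≡ b ⇔ a′ ≡ b′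
    <-⇔    : a < b ⇔ a′ < b′
    succ-⇔ : suc a ≡ b ⇔ suc a′ ≡ b′

open SameOrder

sameOrder-sym : ∀ {a b a′ b′} → SameOrder a b a′ b′ → SameOrder a′ b′ a b
sameOrder-sym s = record
  { ≡-⇔ = ⇔.sym (≡-⇔ s) ; <-⇔ = ⇔.sym (<-⇔ s) ; succ-⇔ = ⇔.sym (succ-⇔ s) }

sameOrder-trans : ∀ {a b a′ b′ a″ b″} →
  SameOrder a b a′ b′ → SameOrder a′ b′ a″ b″ → SameOrder a b a″ b″
sameOrder-trans s s′ = record
  { ≡-⇔    = ⇔.trans (≡-⇔ s) (≡-⇔ s′)
  ; <-⇔    = ⇔.trans (<-⇔ s) (<-⇔ s′)
  ; succ-⇔ = ⇔.trans (succ-⇔ s) (succ-⇔ s′)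
  }

sameOrder-+ : ∀ a b c → SameOrder a b (a + c) (b + c)
sameOrder-+ a b c = record
  { ≡-⇔    = mk⇔ (cong (_+ c)) (+-cancelʳ-≡ c a b)
  ; <-⇔    = mk⇔ (+-monoˡ-< c) (+-cancelʳ-< c a b)
  ; succ-⇔ = mk⇔ (cong (_+ c)) (+-cancelʳ-≡ c (suc a) b)
  }

sameOrder-translate : ∀ {a b a′ b′ δ δ′} →
  a + δ ≡ a′ + δ′ → b + δ ≡ b′ + δ′ → SameOrder a b a′ b′
sameOrder-translate {a} {b} {a′} {b′} {δ} {δ′} ea eb =
  sameOrder-trans (subst₂ (SameOrder a b) ea eb (sameOrder-+ a b δ))
                  (sameOrder-sym (sameOrder-+ a′ b′ δ′))

sameOrder-> : ∀ {a b a′ b′} → b < a → b′ < a′ → SameOrder a b a′ b′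
sameOrder-> b<a b′<a′ = record
  { ≡-⇔    = ⇔-false (>⇒≢ b<a) (>⇒≢ b′<a′)
  ; <-⇔    = ⇔-false (<-asym b<a) (<-asym b′<a′)
  ; succ-⇔ = ⇔-false (not-succ b<a) (not-succ b′<a′)
  }
  where
  not-succ : ∀ {a b} → b < a → suc a ≢ b
  not-succ b<a refl = <-asym b<a (n<1+n _)

succ-across : ∀ {a b α} → a ≤ α → α < b → suc a ≡ b → α ≡ a
succ-across a≤α α<b refl = ≤-antisym (≤-pred α<b) a≤α

sameOrder-across : ∀ {a b a′ b′ α β} → a ≤ α → α < b → a′ ≤ β → β < b′ →
  SameOrder α a β a′ → SameOrder α b β b′ → SameOrder a b a′ b′
sameOrder-across {a} {b} {a′} {b′} a≤α α<b a′≤β β<b′ sa sb = record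
  { ≡-⇔    = ⇔-false (<⇒≢ a<b) (<⇒≢ a′<b′)
  ; <-⇔    = ⇔-true a<b a′<b′
  ; succ-⇔ = mk⇔ (succ-transfer a≤α α<b (to (≡-⇔ sa)) (to (succ-⇔ sb)))
                 (succ-transfer a′≤β β<b′ (from (≡-⇔ sa)) (from (succ-⇔ sb)))
  }
  where
  a<b : a < b
  a<b = ≤-<-trans a≤α α<b
  a′<b′ : a′ < b′
  a′<b′ = ≤-<-trans a′≤β β<b′
  succ-transfer : ∀ {a b a′ b′ α β} → a ≤ α → α < b →
    (α ≡ a → β ≡ a′) → (suc α ≡ b → suc β ≡ b′) → suc a ≡ b → suc a′ ≡ b′
  succ-transfer a≤α α<b ea eb s with refl ← succ-across a≤α α<b s =
    trans (cong suc (sym (ea refl))) (eb s)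

SameType : {m s : ℕ} → Word m → (Fin s → ℕ) → Word m → (Fin s → ℕ) → Set
SameType A t B T = ∀ φ → holds A t φ ≡ holds B T φ

module _ {m s : ℕ} {A B : Word m} {t T : Fin s → ℕ} where

  sameType⇒sameOrder : SameType A t B T → ∀ x y → SameOrder (t x) (t y) (T x) (T y)
  sameType⇒sameOrder ty x y = record
    { ≡-⇔    = ⌊⌋-≡⇒⇔ (t x ≟ t y) (T x ≟ T y) (ty (eq x y))
    ; <-⇔    = ⌊⌋-≡⇒⇔ (t x <? t y) (T x <? T y) (ty (lt x y))
    ; succ-⇔ = ⌊⌋-≡⇒⇔ (suc (t x) ≟ t y) (suc (T x) ≟ T y) (ty (succ x y))
    }

  sameOrder⇒sameType : (∀ x y → SameOrder (t x) (t y) (T x) (T y)) →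
    (∀ x r → lab A (t x) r ≡ lab B (T x) r) → SameType A t B T
  sameOrder⇒sameType so ℓ (rel r x)  = ℓ x r
  sameOrder⇒sameType so ℓ (eq x y)   = ⌊⌋-⇔ (≡-⇔ (so x y)) (t x ≟ t y) (T x ≟ T y)
  sameOrder⇒sameType so ℓ (lt x y)   = ⌊⌋-⇔ (<-⇔ (so x y)) (t x <? t y) (T x <? T y)
  sameOrder⇒sameType so ℓ (succ x y) = ⌊⌋-⇔ (succ-⇔ (so x y)) (suc (t x) ≟ t y) (suc (T x) ≟ T y)

-- Agreement of tuples on one side of a pivot

data Half : Set where
  lower upper : Half

InHalf : Half → ℕ → ℕ → Set
InHalf lower α a = a ≤ α
InHalf upper α a = α < a

inHalf-sameOrder : ∀ h {α a β b} → SameOrder α a β b → InHalf h α a → InHalf h β b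
inHalf-sameOrder lower s a≤α = ≮⇒≥ (λ β<b → ≤⇒≯ a≤α (from (<-⇔ s) β<b))
inHalf-sameOrder upper s α<a = to (<-⇔ s) α<a

-- Relations to the pivots are recorded because they are all that links the two sides:
-- an atom across α can only be succ(α, α + 1).
record Agree {m s : ℕ} (h : Half) (A : Word m) (t : Fin s → ℕ) (α : ℕ)
                                  (B : Word m) (T : Fin s → ℕ) (β : ℕ) : Set where
  field
    pivot : ∀ x → InHalf h α (t x) → SameOrder α (t x) β (T x)
    label : ∀ x → InHalf h α (t x) → ∀ r → lab A (t x) r ≡ lab B (T x) r
    order : ∀ x y → InHalf h α (t x) → InHalf h α (t y) → SameOrder (t x) (t y) (T x) (T y)

  side : ∀ x → InHalf h α (t x) → InHalf h β (T x)
  side x p = inHalf-sameOrder h (pivot x p) p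

module _ {m s : ℕ} {h : Half} {A B : Word m} {t u : Fin s → ℕ} {α β : ℕ} where

  agree-trans : ∀ {C : Word m} {v : Fin s → ℕ} {γ} →
    Agree h A t α B u β → Agree h B u β C v γ → Agree h A t α C v γ
  agree-trans tu uv = record
    { pivot = λ x p → sameOrder-trans (pivot tu x p) (pivot uv x (side tu x p))
    ; label = λ x p r → trans (label tu x p r) (label uv x (side tu x p) r)
    ; order = λ x y p q → sameOrder-trans (order tu x y p q)
                                          (order uv x y (side tu x p) (side tu y q))
    }
    where open Agree

  agree-cong : ∀ {v : Fin s → ℕ} →
    Agree h A t α B u β → (∀ x → InHalf h α (t x) → u x ≡ v x) → Agree h A t α B v β
  agree-cong tu u≗v = record
    { pivot = λ x p → subst (SameOrder α (t x) β) (u≗v x p) (pivot x p)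
    ; label = λ x p r → trans (label x p r) (cong (λ a → lab B a r) (u≗v x p))
    ; order = λ x y p q → subst₂ (SameOrder (t x) (t y)) (u≗v x p) (u≗v y q) (order x y p q)
    }
    where open Agree tu

module _ {m s : ℕ} {h : Half} {A B : Word m} {t T : Fin s → ℕ} {α β : ℕ} where

  agree-translate : (∀ x → InHalf h α (t x) → t x + β ≡ T x + α) →
    (∀ x → InHalf h α (t x) → lab A (t x) ≡ lab B (T x)) → Agree h A t α B T β
  agree-translate shift ℓ = record
    { pivot = λ x p → sameOrder-translate (+-comm α β) (shift x p)
    ; label = λ x p → cong-app (ℓ x p)
    ; order = λ x y p q → sameOrder-translate (shift x p) (shift y q)
    }

sameType⇒agree : ∀ {m n h} {A B : Word m} {t T : Fin (suc n) → ℕ} {α β} →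
  SameType A t B T → t fzero ≡ α → T fzero ≡ β → Agree h A t α B T β
sameType⇒agree {t = t} {T} ty t₀ T₀ = record
  { pivot = λ x _ → subst₂ (λ a b → SameOrder a (t x) b (T x)) t₀ T₀ (sameType⇒sameOrder ty fzero x)
  ; label = λ x _ r → ty (rel r x)
  ; order = λ x y _ _ → sameType⇒sameOrder ty x y
  }

agree-id : ∀ {m s h} {A : Word m} {t u : Fin s → ℕ} {α} →
  (∀ x → InHalf h α (t x) → u x ≡ t x) → Agree h A t α A u α
agree-id {A = A} {α = α} u≗t =
  agree-translate (λ x p → cong (_+ α) (sym (u≗t x p))) (λ x p → cong (lab A) (sym (u≗t x p)))

splice : {s : ℕ} → (Fin s → ℕ) → ℕ → (Fin s → ℕ) → (Fin s → ℕ) → Fin s → ℕ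
splice t α lo hi x = if t x ≤ᵇ α then lo x else hi x

splice-dom : ∀ {m s} {B : Word m} {t lo hi : Fin s → ℕ} {α} →
  (∀ x → t x ≤ α → Dom B (lo x)) → (∀ x → α < t x → Dom B (hi x)) →
  ∀ x → Dom B (splice t α lo hi x)
splice-dom {B = B} {t} {α = α} dlo dhi x with ≤-<-connex (t x) α
... | inj₁ p = subst (Dom B) (sym (if-≤ᵇ-≤ p)) (dlo x p)
... | inj₂ p = subst (Dom B) (sym (if-≤ᵇ-> p)) (dhi x p)

module _ {m s : ℕ} {A B : Word m} {t lo hi : Fin s → ℕ} {α β : ℕ} where

  splice-sameType : Agree lower A t α B lo β → Agree upper A t α B hi β →
    SameType A t B (splice t α lo hi)
  splice-sameType lo-agree hi-agree = sameOrder⇒sameType order label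
    where
    open Agree using (side; pivot)

    below : Agree lower A t α B (splice t α lo hi) β
    below = agree-cong lo-agree (λ x p → sym (if-≤ᵇ-≤ p))

    above : Agree upper A t α B (splice t α lo hi) β
    above = agree-cong hi-agree (λ x p → sym (if-≤ᵇ-> p))

    order : ∀ x y → SameOrder (t x) (t y) (splice t α lo hi x) (splice t α lo hi y)
    order x y with ≤-<-connex (t x) α | ≤-<-connex (t y) α
    ... | inj₁ p | inj₁ q = Agree.order below x y p q
    ... | inj₂ p | inj₂ q = Agree.order above x y p q
    ... | inj₁ p | inj₂ q = sameOrder-across p q (side below x p) (side above y q) (pivot below x p) (pivot above y q)
    ... | inj₂ p | inj₁ q = sameOrder-> (≤-<-trans q p) (≤-<-trans (side below y q) (side above x p))

    label : ∀ x r → lab A (t x) r ≡ lab B (splice t α lo hi x) r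
    label x with ≤-<-connex (t x) α
    ... | inj₁ p = Agree.label below x p
    ... | inj₂ p = Agree.label above x p

record Copy {m n : ℕ} (A : Word m) (t : Fin (suc n) → ℕ) (B : Word m) (b : ℕ) : Set where
  field
    tuple    : Fin (suc n) → ℕ
    dom      : ∀ x → Dom B (tuple x)
    head     : tuple fzero ≡ b
    sameType : SameType A t B tuple

Copies : {m : ℕ} → ℕ → Word m → ℕ → Word m → ℕ → Set
Copies k A a B b = ∀ {n} (t : Fin (suc n) → ℕ) → suc n ≤ k → (∀ x → Dom A (t x)) → t fzero ≡ a →
  Copy A t B b

module _ {m : ℕ} {k : ℕ} {A B : Word m} {a b : ℕ} where

  sameProfile⇒copies : SameProfile k A a B b → Copies k A a B b
  sameProfile⇒copies same t sk dt t₀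
    with _ , T , dT , T₀ , _ , hT ← to (same F _ (holds A t)) (sk , t , dt , t₀ , (λ _ → tt) , λ _ → refl)
    = record { tuple = T ; dom = dT ; head = T₀ ; sameType = sym ∘ hT }

  copies⇒inProfile : ∀ {σ n τ} → Copies k A a B b → InProfile σ k A a n τ → InProfile σ k B b n τ
  copies⇒inProfile {σ} copies (sk , t , dt , t₀ , cd , ht) =
    sk , tuple , dom , head , (λ x → cond σ x (cd x)) , (λ φ → trans (sym (sameType φ)) (ht φ))
    where
    open Copy (copies t sk dt t₀)
    cond : ∀ σ x → Cond σ a (t (fsuc x)) → Cond σ b (tuple (fsuc x))
    cond F x _ = tt
    cond L x c = subst (tuple (fsuc x) <_) head
      (to (<-⇔ (sameType⇒sameOrder sameType (fsuc x) fzero)) (subst (t (fsuc x) <_) (sym t₀) c))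
    cond R x c = subst (_< tuple (fsuc x)) head
      (to (<-⇔ (sameType⇒sameOrder sameType fzero (fsuc x))) (subst (_< t (fsuc x)) (sym t₀) c))

copies⇒sameProfile : ∀ {m k} {A B : Word m} {a b} →
  Copies k A a B b → Copies k B b A a → SameProfile k A a B b
copies⇒sameProfile ab ba σ n τ = mk⇔ (copies⇒inProfile ab) (copies⇒inProfile ba)

sameProfile-sym : ∀ {m k} {A B : Word m} {a b} → SameProfile k A a B b → SameProfile k B b A a
sameProfile-sym same σ n τ = ⇔.sym (same σ n τ)

Dom-downward : ∀ {m} (A : Word m) {p q} → q ≤ p → Dom A p → Dom A q
Dom-downward (fin l)   q≤p p<l = ≤-<-trans q≤p p<l
Dom-downward (omega f) _   _   = tt

-- W′ is W with the segment (i, i + g] deleted.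
module Deletion {m : ℕ} (W W′ : Word m) (i g : ℕ)
  (lab-low  : ∀ p → p ≤ i → lab W′ p ≡ lab W p)
  (lab-high : ∀ p → i < p → lab W′ p ≡ lab W (p + g))
  (dom-high : ∀ p → i < p → Dom W′ p ⇔ Dom W (p + g))
  (dom-c : Dom W′ i) (dom-d : Dom W (i + g))
  {k : ℕ} (same : SameProfile k W i W (i + g)) where

  private
    j : ℕ
    j = i + g

    c↦d : Copies k W i W j
    c↦d = sameProfile⇒copies same

    d↦c : Copies k W j W i
    d↦c = sameProfile⇒copies (sameProfile-sym same)

    i≤j : i ≤ j
    i≤j = m≤m+n i g

    dom-W : ∀ {p} → p ≤ j → Dom W p
    dom-W p≤j = Dom-downward W p≤j dom-d

    dom-W′ : ∀ {p} → p ≤ i → Dom W′ p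
    dom-W′ p≤i = Dom-downward W′ p≤i dom-c

    ∸-above : ∀ {p} → j < p → i < p ∸ g
    ∸-above {p} j<p = m+n≤o⇒m≤o∸n (suc i) j<p

    ∸-+ : ∀ {p} → j < p → p ∸ g + g ≡ p
    ∸-+ j<p = m∸n+n≡m (≤-trans (m≤n+m g i) (<⇒≤ j<p))

    dom-unshift : ∀ {p} → j < p → Dom W p → Dom W′ (p ∸ g)
    dom-unshift j<p d = from (dom-high _ (∸-above j<p)) (subst (Dom W) (sym (∸-+ j<p)) d)

  module _ {s : ℕ} {t u : Fin s → ℕ} where

    keep-lower : (∀ x → t x ≤ i → u x ≡ t x) → Agree lower W′ t i W u i
    keep-lower u≗t = agree-translate (λ x p → cong (_+ i) (sym (u≗t x p)))
      (λ x p → trans (lab-low (t x) p) (cong (lab W) (sym (u≗t x p))))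

    keep-lower′ : (∀ x → t x ≤ i → u x ≡ t x) → Agree lower W t i W′ u i
    keep-lower′ u≗t = agree-translate (λ x p → cong (_+ i) (sym (u≗t x p)))
      (λ x p → trans (sym (lab-low (t x) p)) (cong (lab W′) (sym (u≗t x p))))

    shift-upper : (∀ x → i < t x → u x ≡ t x + g) → Agree upper W′ t i W u j
    shift-upper u≗t+g = agree-translate
      (λ x p → trans (x∙yz≈xz∙y (t x) i g) (cong (_+ i) (sym (u≗t+g x p))))
      (λ x p → trans (lab-high (t x) p) (cong (lab W) (sym (u≗t+g x p))))

    unshift-upper : (∀ x → j < t x → u x ≡ t x ∸ g) → Agree upper W t j W′ u i
    unshift-upper u≗t∸g = agree-translate
      (λ x p → sym (trans (x∙yz≈xz∙y (u x) i g) (cong (_+ i) (u+g x p))))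
      (λ x p → sym (trans (lab-high (u x) (subst (i <_) (sym (u≗t∸g x p)) (∸-above p)))
                          (cong (lab W) (u+g x p))))
      where
      u+g : ∀ x → j < t x → u x + g ≡ t x
      u+g x p = trans (cong (_+ g) (u≗t∸g x p)) (∸-+ p)

  copy-low→ : ∀ {b} → b ≤ i → Copies k W′ b W b
  copy-low→ b≤i {n} t sk dt refl = record
    { tuple    = splice t i t v
    ; dom      = splice-dom {t = t} (λ x p → dom-W (≤-trans p i≤j)) (λ x _ → dom x)
    ; head     = if-≤ᵇ-≤ b≤i
    ; sameType = splice-sameType (keep-lower (λ _ _ → refl))
        (agree-trans (shift-upper (λ x p → if-≤ᵇ-> p)) (sameType⇒agree sameType (if-≤ᵇ-≤ b≤i) head))
    }
    where
    u : Fin (suc n) → ℕ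
    u = splice t i (const j) (λ x → t x + g)
    open Copy (d↦c u sk (splice-dom {t = t} (λ _ _ → dom-d) (λ x p → to (dom-high (t x) p) (dt x))) (if-≤ᵇ-≤ b≤i))
      renaming (tuple to v)

  copy-low← : ∀ {b} → b ≤ i → Copies k W b W′ b
  copy-low← b≤i {n} t sk dt refl = record
    { tuple    = splice t i t (λ x → v x ∸ g)
    ; dom      = splice-dom {t = t} (λ x p → dom-W′ p) (λ x p → dom-unshift (side t↦v x p) (dom x))
    ; head     = if-≤ᵇ-≤ b≤i
    ; sameType = splice-sameType (keep-lower′ (λ _ _ → refl))
        (agree-trans t↦v (unshift-upper (λ _ _ → refl)))
    }
    where
    u : Fin (suc n) → ℕ
    u = splice t i (const i) t
    open Copy (c↦d u sk (splice-dom {t = t} (λ _ _ → dom-W i≤j) (λ x _ → dt x)) (if-≤ᵇ-≤ b≤i))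
      renaming (tuple to v)
    open Agree using (side)
    t↦v : Agree upper W t i W v j
    t↦v = agree-trans (agree-id (λ x p → if-≤ᵇ-> p)) (sameType⇒agree sameType (if-≤ᵇ-≤ b≤i) head)

  copy-high→ : ∀ {b} → i < b → Copies k W′ b W (b + g)
  copy-high→ i<b {n} t sk dt refl = record
    { tuple    = splice t i v (λ x → t x + g)
    ; dom      = splice-dom {t = t} (λ x _ → dom x) (λ x p → to (dom-high (t x) p) (dt x))
    ; head     = if-≤ᵇ-> i<b
    ; sameType = splice-sameType
        (agree-trans (keep-lower (λ x p → if-≤ᵇ-≤ p)) (sameType⇒agree sameType (if-≤ᵇ-> i<b) head))
        (shift-upper (λ _ _ → refl))
    }
    where
    u : Fin (suc n) → ℕ
    u = splice t i t (const i)
    open Copy (c↦d u sk (splice-dom {t = t} (λ x p → dom-W (≤-trans p i≤j)) (λ _ _ → dom-W i≤j)) (if-≤ᵇ-> i<b))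
      renaming (tuple to v)

  copy-high← : ∀ {b} → i < b → Copies k W (b + g) W′ b
  copy-high← {b} i<b {n} t sk dt t₀ = record
    { tuple    = splice t j v (λ x → t x ∸ g)
    ; dom      = splice-dom {t = t} (λ x p → dom-W′ (side t↦v x p)) (λ x p → dom-unshift p (dt x))
    ; head     = trans (if-≤ᵇ-> j<t₀) (trans (cong (_∸ g) t₀) (m+n∸n≡m b g))
    ; sameType = splice-sameType (agree-trans t↦v (keep-lower′ (λ _ _ → refl))) (unshift-upper (λ _ _ → refl))
    }
    where
    j<t₀ : j < t fzero
    j<t₀ = subst (j <_) (sym t₀) (+-monoˡ-< g i<b)
    u : Fin (suc n) → ℕ
    u = splice t j t (const j)
    open Copy (d↦c u sk (splice-dom {t = t} (λ x _ → dt x) (λ _ _ → dom-d)) (if-≤ᵇ-> j<t₀))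
      renaming (tuple to v)
    open Agree using (side)
    t↦v : Agree lower W t j W v i
    t↦v = agree-trans (agree-id (λ x p → if-≤ᵇ-≤ p)) (sameType⇒agree sameType (if-≤ᵇ-> j<t₀) head)

  sameProfile-skip : ∀ b → SameProfile k W′ b W (skip i g b)
  sameProfile-skip b with ≤-<-connex b i
  ... | inj₁ b≤i = subst (SameProfile k W′ b W) (sym (if-≤ᵇ-≤ b≤i))
                         (copies⇒sameProfile (copy-low→ b≤i) (copy-low← b≤i))
  ... | inj₂ i<b = subst (SameProfile k W′ b W) (sym (if-≤ᵇ-> i<b))
                         (copies⇒sameProfile (copy-high→ i<b) (copy-high← i<b))

module _ {m : ℕ} {x : Label m} where

  lab-∷⊙-zero : ∀ xs M → lab ((x ∷ xs) ⊙ M) zero ≡ x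
  lab-∷⊙-zero xs (fin l)   = refl
  lab-∷⊙-zero xs (omega f) = refl

  lab-∷⊙-suc : ∀ xs M p → lab ((x ∷ xs) ⊙ M) (suc p) ≡ lab (xs ⊙ M) p
  lab-∷⊙-suc xs (fin l)   p = refl
  lab-∷⊙-suc xs (omega f) p = refl

  Dom-∷⊙-zero : ∀ xs M → Dom ((x ∷ xs) ⊙ M) zero
  Dom-∷⊙-zero xs (fin l)   = s≤s z≤n
  Dom-∷⊙-zero xs (omega f) = tt

  Dom-∷⊙-suc : ∀ xs M p → Dom ((x ∷ xs) ⊙ M) (suc p) ⇔ Dom (xs ⊙ M) p
  Dom-∷⊙-suc xs (fin l)   p = mk⇔ ≤-pred s≤s
  Dom-∷⊙-suc xs (omega f) p = ⇔.refl

lab-[]⊙ : ∀ {m} (M : Word m) p → lab ([] ⊙ M) p ≡ lab M p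
lab-[]⊙ (fin l)   p = refl
lab-[]⊙ (omega f) p = refl

Dom-[]⊙ : ∀ {m} (M : Word m) p → Dom ([] ⊙ M) p ⇔ Dom M p
Dom-[]⊙ (fin l)   p = ⇔.refl
Dom-[]⊙ (omega f) p = ⇔.refl

lab-⊙-++ʳ : ∀ {m} (xs : List (Label m)) M q → lab (xs ⊙ M) (length xs + q) ≡ lab M q
lab-⊙-++ʳ []       M q = lab-[]⊙ M q
lab-⊙-++ʳ (x ∷ xs) M q = trans (lab-∷⊙-suc xs M _) (lab-⊙-++ʳ xs M q)

Dom-⊙-++ʳ : ∀ {m} (xs : List (Label m)) M q → Dom (xs ⊙ M) (length xs + q) ⇔ Dom M q
Dom-⊙-++ʳ []       M q = Dom-[]⊙ M q
Dom-⊙-++ʳ (x ∷ xs) M q = ⇔.trans (Dom-∷⊙-suc xs M _) (Dom-⊙-++ʳ xs M q)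

lab-⊙-prefix : ∀ {m} (xs : List (Label m)) {x X Y} M M′ {p} → p ≤ length xs →
  lab ((xs ++ x ∷ X) ⊙ M) p ≡ lab ((xs ++ x ∷ Y) ⊙ M′) p
lab-⊙-prefix []       M M′ {zero}  _ = trans (lab-∷⊙-zero _ M) (sym (lab-∷⊙-zero _ M′))
lab-⊙-prefix (y ∷ xs) M M′ {zero}  _ = trans (lab-∷⊙-zero _ M) (sym (lab-∷⊙-zero _ M′))
lab-⊙-prefix (y ∷ xs) M M′ {suc p} (s≤s p≤xs) =
  trans (lab-∷⊙-suc _ M p) (trans (lab-⊙-prefix xs M M′ p≤xs) (sym (lab-∷⊙-suc _ M′ p)))

Dom-⊙-at : ∀ {m} (xs : List (Label m)) {x X} M → Dom ((xs ++ x ∷ X) ⊙ M) (length xs)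
Dom-⊙-at []       M = Dom-∷⊙-zero _ M
Dom-⊙-at (y ∷ xs) M = from (Dom-∷⊙-suc _ M _) (Dom-⊙-at xs M)

lab-⊙-++-shift : ∀ {m} (xs ys : List (Label m)) M {p} → length xs ≤ p →
  lab (xs ⊙ M) p ≡ lab ((xs ++ ys) ⊙ M) (p + length ys)
lab-⊙-++-shift []       ys M {p} _ =
  trans (lab-[]⊙ M p) (sym (trans (cong (lab (ys ⊙ M)) (+-comm p (length ys))) (lab-⊙-++ʳ ys M p)))
lab-⊙-++-shift (y ∷ xs) ys M {suc p} (s≤s xs≤p) =
  trans (lab-∷⊙-suc xs M p) (trans (lab-⊙-++-shift xs ys M xs≤p) (sym (lab-∷⊙-suc _ M _)))

Dom-⊙-++-shift : ∀ {m} (xs ys : List (Label m)) M {p} → length xs ≤ p →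
  Dom (xs ⊙ M) p ⇔ Dom ((xs ++ ys) ⊙ M) (p + length ys)
Dom-⊙-++-shift []       ys M {p} _ =
  ⇔.trans (Dom-[]⊙ M p) (⇔.sym (subst (λ q → Dom (ys ⊙ M) q ⇔ Dom M p) (+-comm (length ys) p) (Dom-⊙-++ʳ ys M p)))
Dom-⊙-++-shift (y ∷ xs) ys M {suc p} (s≤s xs≤p) =
  ⇔.trans (Dom-∷⊙-suc xs M p) (⇔.trans (Dom-⊙-++-shift xs ys M xs≤p) (⇔.sym (Dom-∷⊙-suc _ M _)))

-- The hypotheses 0 < k and b ∈ M′ are unused: when either fails, both profiles are empty.
lemma4p3 : {m : ℕ} (M₁ : List (Label m)) (c : Label m) (M₂ : List (Label m)) (d : Label m) (M₃ : Word m) (k : ℕ) →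
    0 < k →
    SameProfile k ((M₁ ++ c ∷ M₂ ++ d ∷ []) ⊙ M₃) (length M₁) ((M₁ ++ c ∷ M₂ ++ d ∷ []) ⊙ M₃) (length M₁ + suc (length M₂)) →
    (b : ℕ) → Dom ((M₁ ++ c ∷ []) ⊙ M₃) b →
    SameProfile k ((M₁ ++ c ∷ []) ⊙ M₃) b ((M₁ ++ c ∷ M₂ ++ d ∷ []) ⊙ M₃) (skip (length M₁) (suc (length M₂)) b)
lemma4p3 {m} M₁ c M₂ d M₃ k _ same b _ =
  Deletion.sameProfile-skip W W′ (length M₁) (suc (length M₂))
    (λ p → lab-⊙-prefix M₁ M₃ M₃) lab-high dom-high (Dom-⊙-at M₁ M₃) dom-d same b
  where
  M₁c M₂d : List (Label m)
  M₁c = M₁ ++ c ∷ []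
  M₂d = M₂ ++ d ∷ []
  W W′ : Word m
  W = (M₁ ++ c ∷ M₂d) ⊙ M₃
  W′ = M₁c ⊙ M₃
  W-split : (M₁c ++ M₂d) ⊙ M₃ ≡ W
  W-split = cong (_⊙ M₃) (++-assoc M₁ (c ∷ []) M₂d)
  |M₁c|≤ : ∀ {p} → length M₁ < p → length M₁c ≤ p
  |M₁c|≤ = subst (_≤ _) (trans (+-comm 1 _) (sym (length-++ M₁)))
  |M₂d| : length M₂d ≡ suc (length M₂)
  |M₂d| = trans (length-++ M₂) (+-comm _ 1)
  lab-high : ∀ p → length M₁ < p → lab W′ p ≡ lab W (p + suc (length M₂))
  lab-high p i<p = subst₂ (λ w n → lab W′ p ≡ lab w (p + n)) W-split |M₂d| (lab-⊙-++-shift M₁c M₂d M₃ (|M₁c|≤ i<p))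
  dom-high : ∀ p → length M₁ < p → Dom W′ p ⇔ Dom W (p + suc (length M₂))
  dom-high p i<p = subst₂ (λ w n → Dom W′ p ⇔ Dom w (p + n)) W-split |M₂d| (Dom-⊙-++-shift M₁c M₂d M₃ (|M₁c|≤ i<p))
  dom-d : Dom W (length M₁ + suc (length M₂))
  dom-d = subst₂ Dom (cong (_⊙ M₃) (++-assoc M₁ (c ∷ M₂) (d ∷ []))) (length-++ M₁) (Dom-⊙-at (M₁ ++ c ∷ M₂) M₃)
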